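{- Let $\sigma\in\mathrm{Av}_n(312)$ and let $i$ be a descent of $\sigma$. Let $j\in[n]$ be the minimal index such that $\sigma(k)\ge\sigma(i)$ for all $k\in[j,i]$. Let $\tau=\sigma\circ(i\ \ i+1)$ be obtained from $\sigma$ by swapping the entries $\sigma(i)$ and $\sigma(i+1)$. Then \[ \pi_\downarrow(\tau)=\sigma\circ(i+1\ \ i\ \ \cdots\ \ j+1\ \ j), \] where $(i+1\ i\ \cdots\ j)$ is the cyclic permutation sending $i+1\mapsto i\mapsto i-1\mapsto\cdots\mapsto j\mapsto i+1$ (so the entry $\sigma(i+1)$ moves to position $j$ and the entries $\sigma(j),\dots,\sigma(i)$ shift one position right).
   Context: $\mathrm{Av}_n(312)$ is the set of permutations $\sigma\in S_n$ with no indices $i_1<i_2<i_3$ such that $\sigma(i_1)>\sigma(i_3)>\sigma(i_2)$. Permutations are written in one-line notation and $\sigma\circ\pi$ is composition ($(\sigma\circ\pi)(x)=\sigma(\pi(x))$). For $\sigma\in S_n$, an allowable swap exists at $i$ if there is $j$ with $i+1<j$ and $\sigma(i+1)<\sigma(j)<\sigma(i)$, and consists of swapping the entries $\sigma(i)$ and $\sigma(i+1)$. The projection $\pi_\downarrow:S_n\to \mathrm{Av}_n(312)$ sends $\sigma$ to the permutation obtained by repeatedly applying allowable swaps until none is possible; it is known (Defant) that the result is well defined, independent of the order of swaps. -}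

module Defs where

open import Data.Nat as ℕ using (ℕ; zero; suc)
open import Data.Fin using (Fin; zero; suc; toℕ; inject₁; _<_; _≤_; _≟_)
open import Data.Fin.Properties using (_<?_; _≤?_)
open import Data.Vec using (Vec; lookup; tabulate; toList)
open import Data.List.Relation.Unary.Unique.Propositional using (Unique)
open import Data.Product using (Σ; ∃; _×_)
open import Relation.Nullary using (¬_; does)
open import Data.Bool using (if_then_else_; _∧_)
open import Relation.Binary.PropositionalEquality using (_≡_)
open import Relation.Binary.Construct.Closure.ReflexiveTransitive using (Star)

-- Permutations of [n] in one-line notation, 0-indexed: σ = (σ(0) … σ(n-1)).
Perm : ℕ → Set
Perm n = Vec (Fin n) n

IsPerm : ∀ {n} → Perm n → Set
IsPerm σ = Unique (toList σ)

Avoids312 : ∀ {n} → Perm n → Set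
Avoids312 {n} σ = (a b c : Fin n) → a < b → b < c →
  ¬ (lookup σ c < lookup σ a × lookup σ b < lookup σ c)

_∘ₚ_ : ∀ {n} → Perm n → Perm n → Perm n
σ ∘ₚ π = tabulate (λ x → lookup σ (lookup π x))

-- Positions of S_{suc m}: an adjacent pair of positions is (inject₁ p, suc p) for p : Fin m.

transpF : ∀ {m} → Fin m → Fin (suc m) → Fin (suc m)
transpF p x = if does (x ≟ inject₁ p) then suc p
              else (if does (x ≟ suc p) then inject₁ p else x)

transp : ∀ {m} → Fin m → Perm (suc m)
transp p = tabulate (transpF p)

-- the cycle (i+1 i … j+1 j): i+1 ↦ i ↦ … ↦ j ↦ i+1, other points fixed
cycF : ∀ {m} → Fin (suc m) → Fin m → Fin (suc m) → Fin (suc m)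
cycF j i zero = if does (zero ≟ j) then suc i else zero
cycF j i (suc y) =
  if does (suc y ≟ j) then suc i
  else (if does (j <? suc y) ∧ does (y ≤? i) then inject₁ y else suc y)

cyc : ∀ {m} → Fin (suc m) → Fin m → Perm (suc m)
cyc j i = tabulate (cycF j i)

IsDescent : ∀ {m} → Perm (suc m) → Fin m → Set
IsDescent σ i = lookup σ (suc i) < lookup σ (inject₁ i)

BlockAbove : ∀ {n} → Perm n → Fin n → Fin n → Set
BlockAbove {n} σ i j = (k : Fin n) → j ≤ k → k ≤ i → lookup σ i ≤ lookup σ k

IsMinBlockStart : ∀ {n} → Perm n → Fin n → Fin n → Set
IsMinBlockStart {n} σ i j =
  j ≤ i × BlockAbove σ i j × ((j' : Fin n) → j' ≤ i → BlockAbove σ i j' → j ≤ j')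

AllowableAt : ∀ {m} → Perm (suc m) → Fin m → Set
AllowableAt {m} σ p = Σ (Fin (suc m)) λ k →
  suc p < k × lookup σ (suc p) < lookup σ k × lookup σ k < lookup σ (inject₁ p)

SwapStep : ∀ {m} → Perm (suc m) → Perm (suc m) → Set
SwapStep {m} σ σ' = Σ (Fin m) λ p → AllowableAt σ p × σ' ≡ σ ∘ₚ transp p

NoSwap : ∀ {m} → Perm (suc m) → Set
NoSwap {m} σ = (p : Fin m) → ¬ AllowableAt σ p

-- π↓(τ) ≡ ρ : ρ is obtained from τ by repeatedly applying allowable swaps
-- until none is possible (well defined by Defant's theorem).
Proj↓ : ∀ {m} → Perm (suc m) → Perm (suc m) → Set
Proj↓ τ ρ = Star SwapStep τ ρ × NoSwap ρ

-- σ ∘ (i i+1) = σ ∘ (i+1 i) is the claimed shape with i in place of j. For j ≤ p < i the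
-- permutation σ ∘ (i+1 … p+1) has an allowable swap at p, witnessed by position i+1: it holds
-- σ(i), which lies strictly between σ(i+1) (now at p+1) and σ(p) > σ(i) (block condition). The
-- swap yields σ ∘ (i+1 … p), so allowable swaps carry σ(i+1) leftwards down to position j.
-- There no swap is allowable. Away from j the cycle is increasing, so a swap at p with p, p+1 ≠ j
-- would exhibit a 312 in σ. At p = j it would need σ(j) < σ(i+1) < σ(i), against the block. At
-- p + 1 = j minimality of j gives σ(p) < σ(i), so the witness is smaller than σ(i): it cannot
-- come from the block, and beyond i+1 it forms a 312 with the positions i, i+1.
module Submission where

open import Defs
open import Data.Nat as ℕ using (ℕ; zero; suc; s≤s)
import Data.Nat.Properties as ℕ
open import Data.Fin as Fin using (Fin; zero; suc; toℕ; inject₁; _≟_; _≤_; _<_)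
open import Data.Fin.Properties using (toℕ-injective; toℕ-inject₁; _<?_; _≤?_; ≤̄⇒inject₁<)
import Data.Fin.Properties as Fin
open import Data.Vec using (Vec; []; _∷_; lookup; tabulate; toList)
open import Data.Vec.Properties using (lookup∘tabulate; tabulate-cong)
import Data.Vec.Relation.Unary.All.Properties as All
import Data.List.Relation.Unary.Unique.Propositional as List
import Data.Vec.Relation.Unary.Unique.Propositional as Vec
open import Data.Vec.Relation.Unary.Unique.Propositional.Properties using (lookup-injective)
open import Data.Vec.Relation.Unary.AllPairs using ([]; _∷_)
open import Data.List.Relation.Unary.AllPairs using ([]; _∷_)
open import Data.Product using (_,_; proj₁; proj₂)
open import Relation.Binary.Construct.Closure.ReflexiveTransitive using (Star; ε; _◅_)
open import Data.Empty using (⊥)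
open import Function using (_∘_; _$_)
open import Relation.Binary.Definitions using (tri<; tri≈; tri>)
open import Relation.Nullary using (¬_; yes; no; contradiction)
open import Relation.Nullary.Decidable using (dec-true; dec-false)
open import Relation.Binary.PropositionalEquality

unique-toList⁻ : ∀ {A : Set} {n} {xs : Vec A n} → List.Unique (toList xs) → Vec.Unique xs
unique-toList⁻ {xs = []}     []         = []
unique-toList⁻ {xs = x ∷ xs} (x∉ ∷ xs!) = All.toList⁻ x∉ ∷ unique-toList⁻ xs!

lookup-∘ₚ-tabulate : ∀ {n} (σ : Perm n) (f : Fin n → Fin n) x →
                     lookup (σ ∘ₚ tabulate f) x ≡ lookup σ (f x)
lookup-∘ₚ-tabulate σ f x =
  trans (lookup∘tabulate _ x) (cong (lookup σ) (lookup∘tabulate f x))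

tabulate-∘ₚ-tabulate : ∀ {n} (f g : Fin n → Fin n) → tabulate f ∘ₚ tabulate g ≡ tabulate (f ∘ g)
tabulate-∘ₚ-tabulate f g = tabulate-cong λ x →
  trans (lookup∘tabulate f _) (cong f (lookup∘tabulate g x))

∘ₚ-assoc : ∀ {n} (σ π ρ : Perm n) → (σ ∘ₚ π) ∘ₚ ρ ≡ σ ∘ₚ (π ∘ₚ ρ)
∘ₚ-assoc σ π ρ = tabulate-cong λ x →
  trans (lookup∘tabulate _ (lookup ρ x)) (cong (lookup σ) (sym (lookup∘tabulate _ x)))

cycF-start : ∀ {m} (j : Fin (suc m)) (i : Fin m) → cycF j i j ≡ suc i
cycF-start zero    i = refl
cycF-start (suc y) i rewrite dec-true (suc y ≟ suc y) refl = refl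

module _ {m : ℕ} (j : Fin (suc m)) (i : Fin m) where

  cycF-below : ∀ x → x < j → cycF j i x ≡ x
  cycF-below zero x<j
    rewrite dec-false (zero ≟ j) (λ { refl → ℕ.<-irrefl refl x<j }) = refl
  cycF-below (suc y) x<j
    rewrite dec-false (suc y ≟ j) (λ { refl → ℕ.<-irrefl refl x<j })
          | dec-false (j <? suc y) (ℕ.<-asym x<j) = refl

  cycF-inside : (y : Fin m) → j ≤ y → y ≤ i → cycF j i (suc y) ≡ inject₁ y
  cycF-inside y j≤y y≤i
    rewrite dec-false (suc y ≟ j) (λ { refl → ℕ.<-irrefl refl (s≤s j≤y) })
          | dec-true (j <? suc y) (s≤s j≤y)
          | dec-true (y ≤? i) y≤i = refl

  cycF-above : j ≤ i → ∀ x → suc i < x → cycF j i x ≡ x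
  cycF-above j≤i (suc y) i<y
    rewrite dec-false (suc y ≟ j) (λ { refl → ℕ.<⇒≱ i<y (ℕ.m≤n⇒m≤1+n j≤i) })
          | dec-true (j <? suc y) (ℕ.<-trans (s≤s j≤i) i<y)
          | dec-false (y ≤? i) (ℕ.<⇒≱ (ℕ.≤-pred i<y)) = refl

  data CycView (x : Fin (suc m)) : Set where
    start  : x ≡ j → CycView x
    below  : x < j → CycView x
    inside : (y : Fin m) → x ≡ suc y → j ≤ y → y ≤ i → CycView x
    above  : suc i < x → CycView x

  cycView : ∀ x → CycView x
  cycView x with Fin.<-cmp x j
  ... | tri< x<j _ _ = below x<j
  ... | tri≈ _ x≡j _ = start x≡j
  cycView (suc y) | tri> _ _ j<x with y ≤? i
  ... | yes y≤i = inside y refl (ℕ.≤-pred j<x) y≤i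
  ... | no  y≰i = above (s≤s (ℕ.≰⇒> y≰i))

  module _ (j≤i : j ≤ i) where

    cycF-≤ : ∀ x → x ≢ j → toℕ (cycF j i x) ℕ.≤ toℕ x
    cycF-≤ x x≢j with cycView x
    ... | start x≡j = contradiction x≡j x≢j
    ... | below x<j rewrite cycF-below x x<j = ℕ.≤-refl
    ... | inside y refl j≤y y≤i rewrite cycF-inside y j≤y y≤i | toℕ-inject₁ y = ℕ.n≤1+n _
    ... | above i<x rewrite cycF-above j≤i x i<x = ℕ.≤-refl

    cycF-strictMono : ∀ {x y} → x < y → x ≢ j → cycF j i x < cycF j i y
    cycF-strictMono {x} {y} x<y x≢j with cycView y
    ... | start refl rewrite cycF-below x x<y | cycF-start j i =
      ℕ.<-trans (ℕ.<-≤-trans x<y j≤i) (ℕ.n<1+n _)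
    ... | below y<j rewrite cycF-below x (ℕ.<-trans x<y y<j) | cycF-below y y<j = x<y
    ... | above i<y rewrite cycF-above j≤i y i<y = ℕ.≤-<-trans (cycF-≤ x x≢j) x<y
    ... | inside y′ refl j≤y′ y′≤i
      rewrite cycF-inside y′ j≤y′ y′≤i | toℕ-inject₁ y′ = below-inside
      where
      below-inside : toℕ (cycF j i x) ℕ.< toℕ y′
      below-inside with cycView x
      ... | start x≡j = contradiction x≡j x≢j
      ... | below x<j rewrite cycF-below x x<j = ℕ.<-≤-trans x<j j≤y′
      ... | inside x′ refl j≤x′ x′≤i
        rewrite cycF-inside x′ j≤x′ x′≤i | toℕ-inject₁ x′ = ℕ.≤-pred x<y
      ... | above i<x = contradiction (ℕ.<-trans i<x x<y) (ℕ.≤⇒≯ (s≤s y′≤i))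

inject₁<suc : ∀ {m} (p : Fin m) → inject₁ p < suc p
inject₁<suc p = ≤̄⇒inject₁< ℕ.≤-refl

≤-inject₁ˡ : ∀ {a b} {x : Fin a} {y : Fin b} → x ≤ y → inject₁ x ≤ y
≤-inject₁ˡ {x = x} x≤y = subst (ℕ._≤ _) (sym (toℕ-inject₁ x)) x≤y

≤-inject₁ʳ : ∀ {a b} {x : Fin a} {y : Fin b} → x ≤ y → x ≤ inject₁ y
≤-inject₁ʳ {y = y} x≤y = subst (_ ℕ.≤_) (sym (toℕ-inject₁ y)) x≤y

inject₁≤ : ∀ {m} (p : Fin m) → inject₁ p ≤ p
inject₁≤ p = ≤-inject₁ˡ ℕ.≤-refl

module _ {m : ℕ} {p i : Fin m} (p<i : suc p ≤ i) where

  private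
    p≤i : inject₁ p ≤ i
    p≤i = ℕ.≤-trans (inject₁≤ p) (ℕ.<⇒≤ p<i)

  cycF-suc≗cycF-inject₁ : ∀ x → x ≢ inject₁ p → x ≢ suc p →
                          cycF (suc p) i x ≡ cycF (inject₁ p) i x
  cycF-suc≗cycF-inject₁ x x≢p x≢1+p with cycView (inject₁ p) i x
  ... | start x≡p = contradiction x≡p x≢p
  ... | below x<p
    rewrite cycF-below (suc p) i x (ℕ.<-trans x<p (inject₁<suc p))
          | cycF-below (inject₁ p) i x x<p = refl
  ... | inside y refl p≤y y≤i =
    trans (cycF-inside (suc p) i y 1+p≤y y≤i) (sym (cycF-inside (inject₁ p) i y p≤y y≤i))
    where
    1+p≤y : suc p ≤ y
    1+p≤y = ℕ.≤∧≢⇒< (subst (ℕ._≤ toℕ y) (toℕ-inject₁ p) p≤y)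
                    (x≢1+p ∘ cong suc ∘ sym ∘ toℕ-injective)
  ... | above i<x
    rewrite cycF-above (suc p) i p<i x i<x
          | cycF-above (inject₁ p) i p≤i x i<x = refl

  cycF-suc∘transpF : ∀ x → cycF (suc p) i (transpF p x) ≡ cycF (inject₁ p) i x
  cycF-suc∘transpF x with x ≟ inject₁ p
  ... | yes refl = trans (cycF-start (suc p) i) (sym (cycF-start (inject₁ p) i))
  ... | no x≢p with x ≟ suc p
  ...   | yes refl = trans (cycF-below (suc p) i (inject₁ p) (inject₁<suc p))
                           (sym (cycF-inside (inject₁ p) i p (inject₁≤ p) (ℕ.<⇒≤ p<i)))
  ...   | no x≢1+p = cycF-suc≗cycF-inject₁ x x≢p x≢1+p

  cyc-suc∘ₚtransp : cyc (suc p) i ∘ₚ transp p ≡ cyc (inject₁ p) i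
  cyc-suc∘ₚtransp =
    trans (tabulate-∘ₚ-tabulate (cycF (suc p) i) (transpF p)) (tabulate-cong cycF-suc∘transpF)

transpF≗cycF-inject₁ : ∀ {m} (i : Fin m) x → transpF i x ≡ cycF (inject₁ i) i x
transpF≗cycF-inject₁ i x with x ≟ inject₁ i
... | yes refl = sym (cycF-start (inject₁ i) i)
... | no x≢i with x ≟ suc i
...   | yes refl = sym (cycF-inside (inject₁ i) i i (inject₁≤ i) ℕ.≤-refl)
...   | no x≢1+i with cycView (inject₁ i) i x
...     | start x≡i = contradiction x≡i x≢i
...     | below x<i = sym (cycF-below (inject₁ i) i x x<i)
...     | above i<x = sym (cycF-above (inject₁ i) i (inject₁≤ i) x i<x)
...     | inside y refl i≤y y≤i =
  contradiction
    (cong suc (toℕ-injective (ℕ.≤-antisym y≤i (subst (ℕ._≤ toℕ y) (toℕ-inject₁ i) i≤y))))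
    x≢1+i

transp≡cyc-inject₁ : ∀ {m} (i : Fin m) → transp i ≡ cyc (inject₁ i) i
transp≡cyc-inject₁ i = tabulate-cong (transpF≗cycF-inject₁ i)

module _ {m : ℕ} (σ : Perm (suc m)) (σ-perm : IsPerm σ) {i : Fin m} (desc : IsDescent σ i)
         {j : Fin (suc m)} (block : BlockAbove σ (inject₁ i) j) where

  swapStep-cyc : (p : Fin m) → j ≤ p → suc p ≤ i →
                 SwapStep (σ ∘ₚ cyc (suc p) i) (σ ∘ₚ cyc (inject₁ p) i)
  swapStep-cyc p j≤p p<i =
    p , (suc i , s≤s p<i , τ[1+p]<τ[1+i] , τ[1+i]<τ[p]) ,
    sym (trans (∘ₚ-assoc σ (cyc (suc p) i) (transp p)) (cong (σ ∘ₚ_) (cyc-suc∘ₚtransp p<i)))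
    where
    τ : Perm (suc m)
    τ = σ ∘ₚ cyc (suc p) i
    τ[1+p] : lookup τ (suc p) ≡ lookup σ (suc i)
    τ[1+p] = trans (lookup-∘ₚ-tabulate σ (cycF (suc p) i) (suc p))
                   (cong (lookup σ) (cycF-start (suc p) i))
    τ[1+i] : lookup τ (suc i) ≡ lookup σ (inject₁ i)
    τ[1+i] = trans (lookup-∘ₚ-tabulate σ (cycF (suc p) i) (suc i))
                   (cong (lookup σ) (cycF-inside (suc p) i i p<i ℕ.≤-refl))
    τ[p] : lookup τ (inject₁ p) ≡ lookup σ (inject₁ p)
    τ[p] = trans (lookup-∘ₚ-tabulate σ (cycF (suc p) i) (inject₁ p))
                 (cong (lookup σ) (cycF-below (suc p) i (inject₁ p) (inject₁<suc p)))
    τ[1+p]<τ[1+i] : lookup τ (suc p) < lookup τ (suc i)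
    τ[1+p]<τ[1+i] = subst₂ _<_ (sym τ[1+p]) (sym τ[1+i]) desc
    τ[1+i]<τ[p] : lookup τ (suc i) < lookup τ (inject₁ p)
    τ[1+i]<τ[p] = subst₂ _<_ (sym τ[1+i]) (sym τ[p]) (ℕ.≤∧≢⇒<
      (block (inject₁ p) (≤-inject₁ʳ j≤p) (≤-inject₁ʳ (≤-inject₁ˡ (ℕ.<⇒≤ p<i))))
      (ℕ.<⇒≢ p<i ∘ cong toℕ ∘ sym ∘ Fin.inject₁-injective
                 ∘ lookup-injective (unique-toList⁻ σ-perm) _ _ ∘ toℕ-injective))

  -- Recursion on the distance d = q − j, as inject₁ p is not a subterm of suc p.
  swapSteps-cyc : ∀ d (q : Fin (suc m)) → toℕ q ≡ d ℕ.+ toℕ j → q ≤ i →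
                  Star SwapStep (σ ∘ₚ cyc q i) (σ ∘ₚ cyc j i)
  swapSteps-cyc zero    q       q≡j _ rewrite toℕ-injective q≡j = ε
  swapSteps-cyc (suc d) (suc p) q≡ p<i =
    swapStep-cyc p j≤p p<i ◅
    swapSteps-cyc d (inject₁ p) (trans (toℕ-inject₁ p) p≡) (≤-inject₁ˡ (ℕ.<⇒≤ p<i))
    where
    p≡ : toℕ p ≡ d ℕ.+ toℕ j
    p≡ = ℕ.suc-injective q≡
    j≤p : j ≤ p
    j≤p = subst (toℕ j ℕ.≤_) (sym p≡) (ℕ.m≤n+m _ d)

  swapSteps-transp : j ≤ inject₁ i → Star SwapStep (σ ∘ₚ transp i) (σ ∘ₚ cyc j i)
  swapSteps-transp j≤i =
    subst (λ π → Star SwapStep (σ ∘ₚ π) (σ ∘ₚ cyc j i)) (sym (transp≡cyc-inject₁ i)) $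
    swapSteps-cyc (toℕ (inject₁ i) ℕ.∸ toℕ j) (inject₁ i) (sym (ℕ.m∸n+n≡m j≤i)) (inject₁≤ i)

minBlockStart-pred< : ∀ {n} {σ : Perm n} {i j q : Fin n} → IsMinBlockStart σ i j →
                     suc (toℕ q) ≡ toℕ j → lookup σ q < lookup σ i
minBlockStart-pred< {σ = σ} {i} {j} {q} (j≤i , block , minimal) 1+q≡j
  with lookup σ q <? lookup σ i
... | yes σq<σi = σq<σi
... | no  σq≮σi = contradiction (minimal q (ℕ.<⇒≤ (ℕ.<-≤-trans q<j j≤i)) block′) (ℕ.<⇒≱ q<j)
  where
  q<j : q < j
  q<j = ℕ.≤-reflexive 1+q≡j
  block′ : BlockAbove σ i q
  block′ k q≤k k≤i with toℕ q ℕ.≟ toℕ k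
  ... | yes q≡k = subst (λ k → lookup σ i ≤ lookup σ k) (toℕ-injective q≡k) (ℕ.≮⇒≥ σq≮σi)
  ... | no  q≢k = block k (subst (ℕ._≤ toℕ k) 1+q≡j (ℕ.≤∧≢⇒< q≤k q≢k)) k≤i

module _ {m : ℕ} (σ : Perm (suc m)) (avoids : Avoids312 σ) {i : Fin m} (desc : IsDescent σ i)
         {j : Fin (suc m)} (minStart : IsMinBlockStart σ (inject₁ i) j) where

  private
    j≤i : j ≤ i
    j≤i = subst (toℕ j ℕ.≤_) (toℕ-inject₁ i) (proj₁ minStart)

    block : BlockAbove σ (inject₁ i) j
    block = proj₁ (proj₂ minStart)

    ρ : Perm (suc m)
    ρ = σ ∘ₚ cyc j i

    ρ[_] : ∀ x → lookup ρ x ≡ lookup σ (cycF j i x)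
    ρ[ x ] = lookup-∘ₚ-tabulate σ (cycF j i) x

    ρ-at : ∀ x {y} → cycF j i x ≡ y → lookup ρ x ≡ lookup σ y
    ρ-at x c[x]≡y = trans ρ[ x ] (cong (lookup σ) c[x]≡y)

  no-allowable-off-j : (p : Fin m) → inject₁ p ≢ j → suc p ≢ j →
                       ¬ AllowableAt (σ ∘ₚ cyc j i) p
  no-allowable-off-j p p≢j 1+p≢j (k , 1+p<k , ρ[1+p]<ρ[k] , ρ[k]<ρ[p]) =
    avoids (cycF j i (inject₁ p)) (cycF j i (suc p)) (cycF j i k)
      (cycF-strictMono j i j≤i (inject₁<suc p) p≢j) (cycF-strictMono j i j≤i 1+p<k 1+p≢j)
      (subst₂ _<_ ρ[ k ] ρ[ inject₁ p ] ρ[k]<ρ[p] , subst₂ _<_ ρ[ suc p ] ρ[ k ] ρ[1+p]<ρ[k])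

  no-allowable-at-j : (p : Fin m) → inject₁ p ≡ j → ¬ AllowableAt (σ ∘ₚ cyc j i) p
  no-allowable-at-j p p≡j (k , _ , ρ[1+p]<ρ[k] , ρ[k]<ρ[p]) = ℕ.<-irrefl refl $ begin-strict
    toℕ (lookup σ (inject₁ p))  ≡⟨ cong toℕ (ρ-at (suc p) (cycF-inside j i p j≤p p≤i)) ⟨
    toℕ (lookup ρ (suc p))      <⟨ ρ[1+p]<ρ[k] ⟩
    toℕ (lookup ρ k)            <⟨ ρ[k]<ρ[p] ⟩
    toℕ (lookup ρ (inject₁ p))  ≡⟨ cong toℕ (ρ-at (inject₁ p) c[p]≡1+i) ⟩
    toℕ (lookup σ (suc i))      <⟨ desc ⟩
    toℕ (lookup σ (inject₁ i))  ≤⟨ block (inject₁ p) (≤-inject₁ʳ j≤p) (≤-inject₁ʳ (≤-inject₁ˡ p≤i)) ⟩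
    toℕ (lookup σ (inject₁ p))  ∎
    where
    open ℕ.≤-Reasoning
    c[p]≡1+i : cycF j i (inject₁ p) ≡ suc i
    c[p]≡1+i = trans (cong (cycF j i) p≡j) (cycF-start j i)
    j≤p : j ≤ p
    j≤p = ℕ.≤-reflexive (trans (cong toℕ (sym p≡j)) (toℕ-inject₁ p))
    p≤i : p ≤ i
    p≤i = subst (ℕ._≤ toℕ i) (trans (cong toℕ (sym p≡j)) (toℕ-inject₁ p)) j≤i

  no-allowable-before-j : (p : Fin m) → suc p ≡ j → ¬ AllowableAt (σ ∘ₚ cyc j i) p
  no-allowable-before-j p 1+p≡j (k , 1+p<k , ρ[1+p]<ρ[k] , ρ[k]<ρ[p]) =
    from-view (cycView j i k)
    where
    p<j : inject₁ p < j
    p<j = subst (λ a → inject₁ p < a) 1+p≡j (inject₁<suc p)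
    j<k : j < k
    j<k = subst (λ a → a < k) 1+p≡j 1+p<k
    σ[1+i]<ρ[k] : lookup σ (suc i) < lookup ρ k
    σ[1+i]<ρ[k] = subst (λ a → a < lookup ρ k)
      (ρ-at (suc p) (trans (cong (cycF j i) 1+p≡j) (cycF-start j i))) ρ[1+p]<ρ[k]
    ρ[k]<σ[i] : lookup ρ k < lookup σ (inject₁ i)
    ρ[k]<σ[i] = ℕ.<-trans
      (subst (λ a → lookup ρ k < a) (ρ-at (inject₁ p) (cycF-below j i (inject₁ p) p<j)) ρ[k]<ρ[p])
      (minBlockStart-pred< {σ = σ} {q = inject₁ p} minStart
        (trans (cong suc (toℕ-inject₁ p)) (cong toℕ 1+p≡j)))
    from-view : CycView j i k → ⊥
    from-view (start k≡j) = ℕ.<-irrefl (cong toℕ (sym k≡j)) j<k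
    from-view (below k<j) = ℕ.<-asym k<j j<k
    from-view (inside y refl j≤y y≤i) =
      ℕ.<⇒≱ (subst (λ a → a < lookup σ (inject₁ i))
                   (ρ-at (suc y) (cycF-inside j i y j≤y y≤i)) ρ[k]<σ[i])
            (block (inject₁ y) (≤-inject₁ʳ j≤y) (≤-inject₁ʳ (≤-inject₁ˡ y≤i)))
    from-view (above i<k) = avoids (inject₁ i) (suc i) k (inject₁<suc i) i<k
      ( subst (λ a → a < lookup σ (inject₁ i)) ρ[k]≡σ[k] ρ[k]<σ[i]
      , subst (λ a → lookup σ (suc i) < a) ρ[k]≡σ[k] σ[1+i]<ρ[k])
      where
      ρ[k]≡σ[k] : lookup ρ k ≡ lookup σ k
      ρ[k]≡σ[k] = ρ-at k (cycF-above j i j≤i k i<k)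

  noSwap-cyc : NoSwap (σ ∘ₚ cyc j i)
  noSwap-cyc p with suc p ≟ j | inject₁ p ≟ j
  ... | yes 1+p≡j | _        = no-allowable-before-j p 1+p≡j
  ... | no _      | yes p≡j  = no-allowable-at-j p p≡j
  ... | no 1+p≢j  | no p≢j   = no-allowable-off-j p p≢j 1+p≢j

proposition4p2 : (m : ℕ) (σ : Perm (suc m)) → IsPerm σ → Avoids312 σ →
    (i : Fin m) → IsDescent σ i →
    (j : Fin (suc m)) → IsMinBlockStart σ (inject₁ i) j →
    Proj↓ (σ ∘ₚ transp i) (σ ∘ₚ cyc j i)
proposition4p2 m σ σ-perm avoids i desc j minStart@(j≤i , block , _) =
  swapSteps-transp σ σ-perm desc block j≤i , noSwap-cyc σ avoids desc minStart
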